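{- Let \(\mathcal V\) be a universe and let \(D\) be a \(\mathcal V\)-dcpo with least element \(\bot\). A compact element \(x\) of \(D\) is positive if and only if \(x\neq\bot\).
   Context: Setting: intensional Martin-Löf type theory with universes, function extensionality, propositional extensionality, propositional truncation; "there exists" means truncated existence. A poset is a type with a proposition-valued reflexive, transitive, antisymmetric relation \(\sqsubseteq\). A \(\mathcal V\)-dcpo is a poset in which every directed family \(\alpha:I\to D\) with \(I:\mathcal V\) (\(I\) inhabited, and for all \(i,j\) there exists \(k\) with \(\alpha_i,\alpha_j\sqsubseteq\alpha_k\)) has a supremum \(\bigvee\alpha\). An element \(x\) is compact if for every directed family \(\alpha:I\to D\) with \(I:\mathcal V\) and \(x\sqsubseteq\bigvee\alpha\), there exists \(i:I\) with \(x\sqsubseteq\alpha_i\). For \(u\sqsubseteq v\) and a proposition \(P:\mathcal V\), \(\delta_{u,v,P}:\mathbf 1+P\to D\) sends \(\mathrm{inl}(\star)\mapsto u\), \(\mathrm{inr}(p)\mapsto v\) (a directed family, so it has a supremum). \(u\) is strictly below \(v\) if \(u\sqsubseteq v\) and for every \(z\sqsupseteq v\) and proposition \(P:\mathcal V\), \(z=\bigvee\delta_{u,z,P}\) implies \(P\). An element \(y\) is positive if there exists \(u\) strictly below \(y\). -}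

module Defs where

open import Level using (Level; _⊔_; Setω) renaming (suc to lsuc)
open import Data.Product using (Σ; _×_; _,_)
open import Data.Sum using (_⊎_; inj₁; inj₂)
open import Data.Unit.Polymorphic using (⊤; tt)
open import Relation.Binary.PropositionalEquality using (_≡_)

isProp : ∀ {ℓ} → Set ℓ → Set ℓ
isProp A = (x y : A) → x ≡ y

-- The standing axioms of the paper's setting, supplied as hypotheses
-- (Agda --safe has no built-in propositional truncation / funext / propext).
record PropTrunc : Setω where
  field
    ∥_∥       : ∀ {ℓ} → Set ℓ → Set ℓ
    ∣_∣       : ∀ {ℓ} {A : Set ℓ} → A → ∥ A ∥
    ∥∥-isProp : ∀ {ℓ} {A : Set ℓ} → isProp ∥ A ∥
    ∥∥-rec    : ∀ {ℓ ℓ'} {A : Set ℓ} {P : Set ℓ'} → isProp P → (A → P) → ∥ A ∥ → P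

FunExt : Setω
FunExt = ∀ {ℓ ℓ'} {A : Set ℓ} {B : A → Set ℓ'} {f g : (x : A) → B x}
         → ((x : A) → f x ≡ g x) → f ≡ g

PropExt : Setω
PropExt = ∀ {ℓ} {P Q : Set ℓ} → isProp P → isProp Q → (P → Q) → (Q → P) → P ≡ Q

module WithTrunc (T : PropTrunc) where
  open PropTrunc T

  isDirected : ∀ {𝒱 𝒰 𝒯} {D : Set 𝒰} (_⊑_ : D → D → Set 𝒯)
               {I : Set 𝒱} → (I → D) → Set (𝒱 ⊔ 𝒯)
  isDirected _⊑_ {I} α =
    ∥ I ∥ × ((i j : I) → ∥ Σ I (λ k → (α i ⊑ α k) × (α j ⊑ α k)) ∥)

  record DCPO (𝒱 𝒰 𝒯 : Level) : Set (lsuc (𝒱 ⊔ 𝒰 ⊔ 𝒯)) where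
    field
      Carrier   : Set 𝒰
      _⊑_       : Carrier → Carrier → Set 𝒯
      ⊑-prop    : ∀ x y → isProp (x ⊑ y)
      ⊑-refl    : ∀ x → x ⊑ x
      ⊑-trans   : ∀ {x y z} → x ⊑ y → y ⊑ z → x ⊑ z
      ⊑-antisym : ∀ {x y} → x ⊑ y → y ⊑ x → x ≡ y
      ⋁         : {I : Set 𝒱} (α : I → Carrier) → isDirected _⊑_ α → Carrier
      ⋁-upper   : {I : Set 𝒱} (α : I → Carrier) (d : isDirected _⊑_ α)
                  → (i : I) → α i ⊑ ⋁ α d
      ⋁-least   : {I : Set 𝒱} (α : I → Carrier) (d : isDirected _⊑_ α)
                  → (y : Carrier) → ((i : I) → α i ⊑ y) → ⋁ α d ⊑ y

  module _ {𝒱 𝒰 𝒯 : Level} (D : DCPO 𝒱 𝒰 𝒯) where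
    open DCPO D

    isLeast : Carrier → Set (𝒰 ⊔ 𝒯)
    isLeast b = ∀ x → b ⊑ x

    isCompact : Carrier → Set (lsuc 𝒱 ⊔ 𝒰 ⊔ 𝒯)
    isCompact x = {I : Set 𝒱} (α : I → Carrier) (d : isDirected _⊑_ α)
                  → x ⊑ ⋁ α d → ∥ Σ I (λ i → x ⊑ α i) ∥

    δ : (u v : Carrier) (P : Set 𝒱) → (⊤ {𝒱} ⊎ P) → Carrier
    δ u v P (inj₁ _) = u
    δ u v P (inj₂ _) = v

    δ-directed : (u v : Carrier) → u ⊑ v → (P : Set 𝒱)
                 → isDirected _⊑_ (δ u v P)
    δ-directed u v u⊑v P = ∣ inj₁ tt ∣ , dir
      where
        dir : (i j : ⊤ ⊎ P) → ∥ Σ (⊤ ⊎ P) (λ k → (δ u v P i ⊑ δ u v P k)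
                                                × (δ u v P j ⊑ δ u v P k)) ∥
        dir (inj₁ a) (inj₁ b) = ∣ inj₁ tt , ⊑-refl u , ⊑-refl u ∣
        dir (inj₁ a) (inj₂ q) = ∣ inj₂ q , u⊑v , ⊑-refl v ∣
        dir (inj₂ p) (inj₁ b) = ∣ inj₂ p , ⊑-refl v , u⊑v ∣
        dir (inj₂ p) (inj₂ q) = ∣ inj₂ p , ⊑-refl v , ⊑-refl v ∣

    strictlyBelow : Carrier → Carrier → Set (lsuc 𝒱 ⊔ 𝒰 ⊔ 𝒯)
    strictlyBelow u v =
      Σ (u ⊑ v) λ u⊑v →
        (z : Carrier) (v⊑z : v ⊑ z) (P : Set 𝒱) → isProp P
        → z ≡ ⋁ (δ u z P) (δ-directed u z (⊑-trans u⊑v v⊑z) P) → P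

    isPositive : Carrier → Set (lsuc 𝒱 ⊔ 𝒰 ⊔ 𝒯)
    isPositive y = ∥ Σ Carrier (λ u → strictlyBelow u y) ∥

{-# OPTIONS --safe #-}
module Submission where

open import Defs
open import Level using (Level)
open import Data.Product using (_×_; _,_; Σ)
open import Data.Sum using (inj₁; inj₂)
open import Data.Empty using (⊥-elim)
open import Data.Empty.Polymorphic using () renaming (⊥ to Empty; ⊥-elim to Empty-elim)
open import Relation.Binary.PropositionalEquality using (_≡_; subst; sym)
open import Relation.Nullary using (¬_)

-- A strictly-below witness u for y can never be inserted beneath a least
-- element, since then y = ⋁ δ_{u,y,𝟘}, forcing 𝟘.  Conversely, for a compact
-- x above u, any equation z = ⋁ δ_{u,z,P} with x ⊑ z puts x below u or
-- yields P; the first is impossible when x ≠ u.  Taking u = ⊥ gives both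
-- directions.

module _ (T : PropTrunc) where
  open PropTrunc T
  open WithTrunc T

  module _ {𝒱 𝒰 𝒯 : Level} (D : DCPO 𝒱 𝒰 𝒯) where
    open DCPO D

    ⋁-δ-⊑ : ∀ {u v} (u⊑v : u ⊑ v) (P : Set 𝒱)
            → ⋁ (δ D u v P) (δ-directed D u v u⊑v P) ⊑ v
    ⋁-δ-⊑ {u} {v} u⊑v P = ⋁-least _ _ v upper
      where
        upper : ∀ i → δ D u v P i ⊑ v
        upper (inj₁ _) = u⊑v
        upper (inj₂ _) = ⊑-refl v

    strictlyBelow⇒¬isLeast : ∀ {u v} → strictlyBelow D u v → ¬ isLeast D v
    strictlyBelow⇒¬isLeast {u} {v} (u⊑v , below) v-least =
      Empty-elim (below v (⊑-refl v) Empty (λ ()) v≡⋁δ)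
      where
        v≡⋁δ : v ≡ ⋁ (δ D u v Empty) (δ-directed D u v (⊑-trans u⊑v (⊑-refl v)) Empty)
        v≡⋁δ = ⊑-antisym (v-least _) (⋁-δ-⊑ _ Empty)

    isPositive⇒¬isLeast : ∀ {y} → isPositive D y → ¬ isLeast D y
    isPositive⇒¬isLeast pos y-least =
      ∥∥-rec (λ ()) (λ (u , u≪y) → strictlyBelow⇒¬isLeast u≪y y-least) pos

    compact⇒strictlyBelow : ∀ {u x} → u ⊑ x → isCompact D x → ¬ (x ≡ u)
                            → strictlyBelow D u x
    compact⇒strictlyBelow {u} {x} u⊑x x-compact x≢u = u⊑x , below
      where
        below : (z : Carrier) (x⊑z : x ⊑ z) (P : Set 𝒱) → isProp P
                → z ≡ ⋁ (δ D u z P) (δ-directed D u z (⊑-trans u⊑x x⊑z) P) → P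
        below z x⊑z P P-prop z≡⋁δ =
          ∥∥-rec P-prop reached (x-compact _ _ (subst (x ⊑_) z≡⋁δ x⊑z))
          where
            reached : Σ _ (λ i → x ⊑ δ D u z P i) → P
            reached (inj₁ _ , x⊑u) = ⊥-elim (x≢u (⊑-antisym x⊑u u⊑x))
            reached (inj₂ p , _)   = p

proposition3p14 : (T : PropTrunc) → FunExt → PropExt
    → {𝒱 𝒰 𝒯 : Level} (D : WithTrunc.DCPO T 𝒱 𝒰 𝒯)
    → (⊥ : WithTrunc.DCPO.Carrier D) → WithTrunc.isLeast T D ⊥
    → (x : WithTrunc.DCPO.Carrier D) → WithTrunc.isCompact T D x
    → (WithTrunc.isPositive T D x → ¬ (x ≡ ⊥))
      × (¬ (x ≡ ⊥) → WithTrunc.isPositive T D x)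
proposition3p14 T _ _ D ⊥ ⊥-least x x-compact =
    (λ x-positive x≡⊥ →
       isPositive⇒¬isLeast T D x-positive (subst (isLeast D) (sym x≡⊥) ⊥-least))
  , (λ x≢⊥ → ∣ ⊥ , compact⇒strictlyBelow T D (⊥-least x) x-compact x≢⊥ ∣)
  where
    open PropTrunc T
    open WithTrunc T
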